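{- For all positive integers $n_1,n_2$, the digraph $R'_{1,2n_1,2n_2}$ is a transitive orientation of the graph $\overline{H_{1,2n_1,2n_2}}$. In particular $\overline{H_{1,2n_1,2n_2}}$ is a comparability graph.
   Context: A transitive orientation of a graph $G$ is a transitive digraph on $V(G)$ obtained by replacing each edge $\{x,y\}$ by exactly one of $(x,y),(y,x)$ (and no other arcs); a comparability graph is a graph admitting one. $\overline{G}$ is the complement of $G$; $D^\star$ is the dual of a digraph $D$ (arcs reversed). For $n\ge0$, $t_n(p)=p+n$ and $t_n(\cdot)$ shifts vertices by $n$. Put $s_2=n_1+n_2$. - $G_{2n}$: graph on $\{0,\ldots,2n-1\}$, edges $\{2i,2j+1\}$, $0\le i\le j\le n-1$; $G'_{2n}$: edges $E(G_{2n})\cup\{\{2p-1,2q-1\}:1\le p<q\le n\}$. - $H_{1,2n_1,2n_2}$: graph on $\{0,\ldots,2s_2\}$ with edges $E(t_1(G'_{2n_1}))\cup E(t_{2n_1+1}(G'_{2n_2}))\cup\{\{2p,2q\}:0\le p<q\le s_2\}$. - $R'_{2n}$: digraph on $\{0,\ldots,2n-1\}$ with arcs $(2i,2j),(2i+1,2j)$ for $0\le i<j\le n-1$. - $R'_{1,2n_1,2n_2}$: digraph on $\{0,\ldots,2s_2\}$ with arcs $A(t_1(R'_{2n_1}))\cup A(t_{2n_1+1}((R'_{2n_2})^\star))\cup\{(2q-1,p):0\le p\le 2n_1,\ n_1+1\le q\le s_2\}\cup\{(2q,2p-1):1\le p\le n_1 \text{ and } (n_1+1\le q\le s_2 \text{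 or } q=0)\}$. -}

module Defs where

open import Data.Nat using (ℕ; zero; suc; _+_; _*_; _∸_; _≤_; _<_)
open import Data.Product using (Σ; Σ-syntax; _×_; ∃-syntax)
open import Data.Sum using (_⊎_)
open import Relation.Nullary using (¬_)
open import Relation.Binary.PropositionalEquality using (_≡_; _≢_)

Rel : Set₁
Rel = ℕ → ℕ → Set

-- A (finite simple) graph on vertex set {0,…,size-1}; Adj x y means {x,y} is an edge.
-- We build graphs from an edge generator E (each edge {x,y} listed as E x y),
-- taking Adj to be its symmetric closure.
record Graph : Set₁ where
  constructor mkGraph
  field
    size : ℕ
    Adj  : Rel
open Graph public

record Digraph : Set₁ where
  constructor mkDigraph
  field
    dsize : ℕ
    Arc   : Rel
open Digraph public

Sym : Rel → Rel
Sym E x y = E x y ⊎ E y x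

shift : ℕ → Rel → Rel
shift n R x y = Σ[ p ∈ ℕ ] Σ[ q ∈ ℕ ] (x ≡ p + n × y ≡ q + n × R p q)

dual : Rel → Rel
dual R x y = R y x

complement : Graph → Graph
complement G = mkGraph (size G)
  (λ x y → x < size G × y < size G × x ≢ y × ¬ Adj G x y)

record IsTransitiveOrientation (D : Digraph) (G : Graph) : Set where
  field
    sameVertices : dsize D ≡ size G
    arcIsEdge    : ∀ x y → Arc D x y → Adj G x y
    edgeHasArc   : ∀ x y → Adj G x y → Arc D x y ⊎ Arc D y x
    notBoth      : ∀ x y → Adj G x y → ¬ (Arc D x y × Arc D y x)
    transitive   : ∀ x y z → Arc D x y → Arc D y z → Arc D x z

IsComparabilityGraph : Graph → Set₁
IsComparabilityGraph G = Σ[ D ∈ Digraph ] IsTransitiveOrientation D G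

G-gen : ℕ → Rel
G-gen n x y = Σ[ i ∈ ℕ ] Σ[ j ∈ ℕ ] (i ≤ j × j < n × x ≡ 2 * i × y ≡ 2 * j + 1)

G'-gen : ℕ → Rel
G'-gen n x y = G-gen n x y ⊎
  (Σ[ p ∈ ℕ ] Σ[ q ∈ ℕ ] (1 ≤ p × p < q × q ≤ n × x ≡ 2 * p ∸ 1 × y ≡ 2 * q ∸ 1))

H-gen : ℕ → ℕ → Rel
H-gen n₁ n₂ x y =
  shift 1 (G'-gen n₁) x y ⊎
  (shift (2 * n₁ + 1) (G'-gen n₂) x y ⊎
   (Σ[ p ∈ ℕ ] Σ[ q ∈ ℕ ] (p < q × q ≤ n₁ + n₂ × x ≡ 2 * p × y ≡ 2 * q)))

H : ℕ → ℕ → Graph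
H n₁ n₂ = mkGraph (2 * (n₁ + n₂) + 1) (Sym (H-gen n₁ n₂))

R'-arc : ℕ → Rel
R'-arc n x y = Σ[ i ∈ ℕ ] Σ[ j ∈ ℕ ] (i < j × j < n ×
  ((x ≡ 2 * i × y ≡ 2 * j) ⊎ (x ≡ 2 * i + 1 × y ≡ 2 * j)))

R-arc : ℕ → ℕ → Rel
R-arc n₁ n₂ x y =
  shift 1 (R'-arc n₁) x y ⊎
  (shift (2 * n₁ + 1) (dual (R'-arc n₂)) x y ⊎
  ((Σ[ p ∈ ℕ ] Σ[ q ∈ ℕ ] (p ≤ 2 * n₁ × n₁ + 1 ≤ q × q ≤ n₁ + n₂ ×
      x ≡ 2 * q ∸ 1 × y ≡ p)) ⊎
   (Σ[ p ∈ ℕ ] Σ[ q ∈ ℕ ] (1 ≤ p × p ≤ n₁ ×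
      ((n₁ + 1 ≤ q × q ≤ n₁ + n₂) ⊎ q ≡ 0) ×
      x ≡ 2 * q × y ≡ 2 * p ∸ 1))))

R : ℕ → ℕ → Digraph
R n₁ n₂ = mkDigraph (2 * (n₁ + n₂) + 1) (R-arc n₁ n₂)

{-# OPTIONS --safe #-}
-- Write each vertex as 2m or 2a+1.  In these coordinates adjacency in H and the
-- arcs of R become simple conditions on m, a and n₁.  The arc relation is a
-- strict order: on odd vertices it is the linear order listing first the 2a+1
-- with a ≥ n₁ by decreasing a, then those with a < n₁ by increasing a, and 2m
-- is placed by comparing m with a and with n₁.  Two distinct vertices are
-- comparable in it exactly when they are non-adjacent in H, which is a finite
-- case analysis on inequalities.
module Submission where

open import Defs
open import Data.Nat using (ℕ; zero; suc; _+_; _*_; _∸_; _≤_; _<_; z≤n; s≤s)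
open import Data.Nat.Properties
open import Data.Nat.Tactic.RingSolver using (solve-∀)
open import Data.Product using (_×_; _,_; Σ; proj₂)
open import Data.Sum using (_⊎_; inj₁; inj₂; swap)
import Data.Sum as Sum
open import Function using (_∘_)
open import Data.Empty using (⊥; ⊥-elim)
open import Relation.Nullary using (¬_; yes; no)
open import Relation.Binary.Definitions using (tri<; tri≈; tri>)
open import Relation.Binary.PropositionalEquality

odd+1≡even : ∀ i → 2 * i + 1 + 1 ≡ 2 * suc i
odd+1≡even = solve-∀

odd+odd≡even : ∀ k j → 2 * j + 1 + (2 * k + 1) ≡ 2 * suc (k + j)
odd+odd≡even = solve-∀

odd+even≡odd : ∀ k i → 2 * i + (2 * k + 1) ≡ 2 * (k + i) + 1
odd+even≡odd = solve-∀

even∸1≡odd : ∀ p → 2 * suc p ∸ 1 ≡ 2 * p + 1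
even∸1≡odd p = trans (cong (_∸ 1) (sym (odd+1≡even p))) (m+n∸n≡m (2 * p + 1) 1)

even∸1+1≡even : ∀ p → 2 * suc p ∸ 1 + 1 ≡ 2 * suc p
even∸1+1≡even p = trans (cong (_+ 1) (even∸1≡odd p)) (odd+1≡even p)

even∸1+odd≡even : ∀ k p → 2 * suc p ∸ 1 + (2 * k + 1) ≡ 2 * suc (k + p)
even∸1+odd≡even k p = trans (cong (_+ (2 * k + 1)) (even∸1≡odd p)) (odd+odd≡even k p)

even≢odd+1 : ∀ a b → 2 * a ≢ 2 * b + 1
even≢odd+1 a b e = even≢odd a b (trans e (+-comm (2 * b) 1))

*2-injective : ∀ a b → 2 * a ≡ 2 * b → a ≡ b
*2-injective a b = *-cancelˡ-≡ a b 2

odd-injective : ∀ a b → 2 * a + 1 ≡ 2 * b + 1 → a ≡ b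
odd-injective a b e = *2-injective a b (+-cancelʳ-≡ 1 (2 * a) (2 * b) e)

odd≤even⇒< : ∀ {a n} → 2 * a + 1 ≤ 2 * n → a < n
odd≤even⇒< {a} {n} h = *-cancelˡ-≤ 2 (subst (_≤ 2 * n) (odd+1≡even a) 2a+2≤2n)
  where
  2a+2≤2n : 2 * a + 1 + 1 ≤ 2 * n
  2a+2≤2n = subst (_≤ 2 * n) (+-comm 1 (2 * a + 1))
    (≤∧≢⇒< h (λ e → even≢odd+1 n a (sym e)))

<⇒odd≤even : ∀ {a n} → a < n → 2 * a + 1 ≤ 2 * n
<⇒odd≤even {a} {n} h =
  ≤-trans (m≤m+n (2 * a + 1) 1) (subst (_≤ 2 * n) (sym (odd+1≡even a)) (*-monoʳ-≤ 2 h))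

≤⇒<+1 : ∀ {x y} → x ≤ y → x < y + 1
≤⇒<+1 {x} {y} h = subst (x <_) (+-comm 1 y) (s≤s h)

<+1⇒≤ : ∀ {x y} → x < y + 1 → x ≤ y
<+1⇒≤ {x} {y} h = ≤-pred (subst (x <_) (+-comm y 1) h)

≤⇒∃+ : ∀ {k a} → k ≤ a → Σ ℕ (λ i → a ≡ k + i)
≤⇒∃+ h with m≤n⇒∃[o]m+o≡n h
... | i , e = i , sym e

data Vertex : Set where
  even odd : ℕ → Vertex

⟦_⟧ : Vertex → ℕ
⟦ even m ⟧ = 2 * m
⟦ odd a ⟧ = 2 * a + 1

⟦⟧-surjective : ∀ x → Σ Vertex (λ v → x ≡ ⟦ v ⟧)
⟦⟧-surjective zero = even 0 , refl
⟦⟧-surjective (suc x) with ⟦⟧-surjective x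
... | even m , refl = odd m , +-comm 1 (2 * m)
... | odd a , refl = even (suc a) , trans (+-comm 1 (2 * a + 1)) (odd+1≡even a)

⟦⟧≡even⇒ : ∀ v k → ⟦ v ⟧ ≡ 2 * k → v ≡ even k
⟦⟧≡even⇒ (even m) k e = cong even (*2-injective m k e)
⟦⟧≡even⇒ (odd a) k e = ⊥-elim (even≢odd+1 k a (sym e))

⟦⟧≡odd⇒ : ∀ v k → ⟦ v ⟧ ≡ 2 * k + 1 → v ≡ odd k
⟦⟧≡odd⇒ (even m) k e = ⊥-elim (even≢odd+1 m k e)
⟦⟧≡odd⇒ (odd a) k e = cong odd (odd-injective a k e)

⟦⟧-injective : ∀ v w → ⟦ v ⟧ ≡ ⟦ w ⟧ → v ≡ w
⟦⟧-injective v (even m) e = ⟦⟧≡even⇒ v m e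
⟦⟧-injective v (odd a) e = ⟦⟧≡odd⇒ v a e

module Coordinates (n₁ n₂ : ℕ) where

  InRange : Vertex → Set
  InRange (even m) = m ≤ n₁ + n₂
  InRange (odd a) = a < n₁ + n₂

  InRange⇒< : ∀ v → InRange v → ⟦ v ⟧ < 2 * (n₁ + n₂) + 1
  InRange⇒< (even m) h = ≤⇒<+1 (*-monoʳ-≤ 2 h)
  InRange⇒< (odd a) h = ≤⇒<+1 (<⇒odd≤even h)

  <⇒InRange : ∀ v → ⟦ v ⟧ < 2 * (n₁ + n₂) + 1 → InRange v
  <⇒InRange (even m) h = *-cancelˡ-≤ 2 (<+1⇒≤ h)
  <⇒InRange (odd a) h = odd≤even⇒< (<+1⇒≤ h)

  HEdge : Vertex → Vertex → Set
  HEdge (even m) (even m') = m ≢ m'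
  HEdge (odd a) (even m) = a < m × (a < n₁ → m ≤ n₁)
  HEdge (even m) (odd a) = a < m × (a < n₁ → m ≤ n₁)
  HEdge (odd _) (odd _) = ⊥

  RArc : Vertex → Vertex → Set
  RArc (odd a) (odd a') = (a < a' × a' < n₁) ⊎ ((n₁ ≤ a' × a' < a) ⊎ (a' < n₁ × n₁ ≤ a))
  RArc (even m) (odd a) = a < n₁ × (m ≤ a ⊎ n₁ < m)
  RArc (odd a) (even m) = n₁ ≤ a × m ≤ a
  RArc (even _) (even _) = ⊥

  HEdge-sym : ∀ v w → HEdge v w → HEdge w v
  HEdge-sym (even m) (even m') h = λ e → h (sym e)
  HEdge-sym (even m) (odd a) h = h
  HEdge-sym (odd a) (even m) h = h

  H-gen⇒HEdge : ∀ v w → H-gen n₁ n₂ ⟦ v ⟧ ⟦ w ⟧ → HEdge v w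
  H-gen⇒HEdge v w (inj₁ (_ , _ , ex , ey , inj₁ (i , j , i≤j , j<n , refl , refl)))
    with ⟦⟧≡odd⇒ v i ex | ⟦⟧≡even⇒ w (suc j) (trans ey (odd+1≡even j))
  ... | refl | refl = s≤s i≤j , λ _ → j<n
  H-gen⇒HEdge v w (inj₁ (_ , _ , ex , ey ,
      inj₂ (suc p , suc q , s≤s z≤n , p<q , _ , refl , refl)))
    with ⟦⟧≡even⇒ v (suc p) (trans ex (even∸1+1≡even p))
       | ⟦⟧≡even⇒ w (suc q) (trans ey (even∸1+1≡even q))
  ... | refl | refl = λ e → <-irrefl e p<q
  H-gen⇒HEdge v w (inj₂ (inj₁ (_ , _ , ex , ey , inj₁ (i , j , i≤j , _ , refl , refl))))
    with ⟦⟧≡odd⇒ v (n₁ + i) (trans ex (odd+even≡odd n₁ i))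
       | ⟦⟧≡even⇒ w (suc (n₁ + j)) (trans ey (odd+odd≡even n₁ j))
  ... | refl | refl = s≤s (+-monoʳ-≤ n₁ i≤j) , λ h → ⊥-elim (≤⇒≯ (m≤m+n n₁ i) h)
  H-gen⇒HEdge v w (inj₂ (inj₁ (_ , _ , ex , ey ,
      inj₂ (suc p , suc q , s≤s z≤n , p<q , _ , refl , refl))))
    with ⟦⟧≡even⇒ v (suc (n₁ + p)) (trans ex (even∸1+odd≡even n₁ p))
       | ⟦⟧≡even⇒ w (suc (n₁ + q)) (trans ey (even∸1+odd≡even n₁ q))
  ... | refl | refl = λ e → <-irrefl (cong suc (+-cancelˡ-≡ n₁ p q (suc-injective e))) p<q
  H-gen⇒HEdge v w (inj₂ (inj₂ (p , q , p<q , _ , ex , ey)))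
    with ⟦⟧≡even⇒ v p ex | ⟦⟧≡even⇒ w q ey
  ... | refl | refl = λ e → <-irrefl e p<q

  H-adj⇒HEdge : ∀ v w → Adj (H n₁ n₂) ⟦ v ⟧ ⟦ w ⟧ → HEdge v w
  H-adj⇒HEdge v w (inj₁ g) = H-gen⇒HEdge v w g
  H-adj⇒HEdge v w (inj₂ g) = HEdge-sym w v (H-gen⇒HEdge w v g)

  HEdge⇒H-gen : ∀ a m → InRange (even m) → HEdge (odd a) (even m) →
                H-gen n₁ n₂ ⟦ odd a ⟧ ⟦ even m ⟧
  HEdge⇒H-gen a m rm (a<m , imp) with a <? n₁
  HEdge⇒H-gen a (suc j) rm (s≤s a≤j , imp) | yes a<n =
    inj₁ (2 * a , 2 * j + 1 , refl , sym (odd+1≡even j) ,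
      inj₁ (a , j , a≤j , imp a<n , refl , refl))
  HEdge⇒H-gen a m rm (a<m , imp) | no a≮n with ≤⇒∃+ (≮⇒≥ a≮n)
  HEdge⇒H-gen .(n₁ + i) (suc m) rm (s≤s a≤m , imp) | no a≮n | i , refl
    with ≤⇒∃+ (≤-trans (m≤m+n n₁ i) a≤m)
  ... | j , refl =
    inj₂ (inj₁ (2 * i , 2 * j + 1 , sym (odd+even≡odd n₁ i) , sym (odd+odd≡even n₁ j) ,
      inj₁ (i , j , +-cancelˡ-≤ n₁ i j a≤m ,
        +-cancelˡ-≤ n₁ (suc j) n₂ (subst (_≤ n₁ + n₂) (sym (+-suc n₁ j)) rm) ,
        refl , refl)))

  HEdge⇒H-adj : ∀ v w → InRange v → InRange w → HEdge v w → Adj (H n₁ n₂) ⟦ v ⟧ ⟦ w ⟧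
  HEdge⇒H-adj (even m) (even m') rv rw h with <-cmp m m'
  ... | tri< lt _ _ = inj₁ (inj₂ (inj₂ (m , m' , lt , rw , refl , refl)))
  ... | tri≈ _ eq _ = ⊥-elim (h eq)
  ... | tri> _ _ gt = inj₂ (inj₂ (inj₂ (m' , m , gt , rv , refl , refl)))
  HEdge⇒H-adj (odd a) (even m) rv rw h = inj₁ (HEdge⇒H-gen a m rw h)
  HEdge⇒H-adj (even m) (odd a) rv rw h = inj₂ (HEdge⇒H-gen a m rv h)

  n₁≤s₂ : n₁ ≤ n₁ + n₂
  n₁≤s₂ = m≤m+n n₁ n₂

  n₁+1≤⇒n₁< : ∀ {q} → n₁ + 1 ≤ q → n₁ < q
  n₁+1≤⇒n₁< {q} = subst (_≤ q) (+-comm n₁ 1)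

  n₁<⇒n₁+1≤ : ∀ {q} → n₁ < q → n₁ + 1 ≤ q
  n₁<⇒n₁+1≤ {q} = subst (_≤ q) (+-comm 1 n₁)

  n₁<⇒suc : ∀ {q} → n₁ < q → Σ ℕ (λ q' → q ≡ suc q' × n₁ ≤ q')
  n₁<⇒suc {suc q'} (s≤s h) = q' , refl , h

  R-arc⇒RArc : ∀ v w → R-arc n₁ n₂ ⟦ v ⟧ ⟦ w ⟧ → InRange v × InRange w × RArc v w
  R-arc⇒RArc v w (inj₁ (_ , _ , ex , ey , (i , j , i<j , j<n , inj₁ (refl , refl))))
    with ⟦⟧≡odd⇒ v i ex | ⟦⟧≡odd⇒ w j ey
  ... | refl | refl = <-trans i<j j<s , j<s , inj₁ (i<j , j<n)
    where j<s = <-≤-trans j<n n₁≤s₂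
  R-arc⇒RArc v w (inj₁ (_ , _ , ex , ey , (i , j , i<j , j<n , inj₂ (refl , refl))))
    with ⟦⟧≡even⇒ v (suc i) (trans ex (odd+1≡even i)) | ⟦⟧≡odd⇒ w j ey
  ... | refl | refl = <-trans i<j j<s , j<s , (j<n , inj₁ i<j)
    where j<s = <-≤-trans j<n n₁≤s₂
  R-arc⇒RArc v w (inj₂ (inj₁ (_ , _ , ex , ey , (i , j , i<j , j<n , inj₁ (refl , refl)))))
    with ⟦⟧≡odd⇒ v (n₁ + j) (trans ex (odd+even≡odd n₁ j))
       | ⟦⟧≡odd⇒ w (n₁ + i) (trans ey (odd+even≡odd n₁ i))
  ... | refl | refl = j<s , <-trans (+-monoʳ-< n₁ i<j) j<s ,
      inj₂ (inj₁ (m≤m+n n₁ i , +-monoʳ-< n₁ i<j))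
    where j<s = +-monoʳ-< n₁ j<n
  R-arc⇒RArc v w (inj₂ (inj₁ (_ , _ , ex , ey , (i , j , i<j , j<n , inj₂ (refl , refl)))))
    with ⟦⟧≡odd⇒ v (n₁ + j) (trans ex (odd+even≡odd n₁ j))
       | ⟦⟧≡even⇒ w (suc (n₁ + i)) (trans ey (odd+odd≡even n₁ i))
  ... | refl | refl = j<s , <-trans (+-monoʳ-< n₁ i<j) j<s ,
      (m≤m+n n₁ j , +-monoʳ-< n₁ i<j)
    where j<s = +-monoʳ-< n₁ j<n
  R-arc⇒RArc v w (inj₂ (inj₂ (inj₁ (p , q , p≤ , q≥ , q≤s , ex , refl))))
    with n₁<⇒suc (n₁+1≤⇒n₁< q≥)
  ... | q' , refl , n≤q' with ⟦⟧≡odd⇒ v q' (trans ex (even∸1≡odd q'))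
  R-arc⇒RArc v (odd a) (inj₂ (inj₂ (inj₁ (p , q , p≤ , _ , q≤s , _ , refl))))
    | q' , refl , n≤q' | refl =
    q≤s , <-≤-trans (odd≤even⇒< p≤) n₁≤s₂ , inj₂ (inj₂ (odd≤even⇒< p≤ , n≤q'))
  R-arc⇒RArc v (even m) (inj₂ (inj₂ (inj₁ (p , q , p≤ , _ , q≤s , _ , refl))))
    | q' , refl , n≤q' | refl =
    q≤s , ≤-trans m≤n₁ n₁≤s₂ , (n≤q' , ≤-trans m≤n₁ n≤q')
    where m≤n₁ = *-cancelˡ-≤ 2 p≤
  R-arc⇒RArc v w (inj₂ (inj₂ (inj₂ (suc p , q , s≤s z≤n , p≤ , q-range , ex , ey))))
    with ⟦⟧≡even⇒ v q ex | ⟦⟧≡odd⇒ w p (trans ey (even∸1≡odd p)) | q-range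
  ... | refl | refl | inj₁ (q≥ , q≤s) = q≤s , <-≤-trans p≤ n₁≤s₂ , (p≤ , inj₂ (n₁+1≤⇒n₁< q≥))
  ... | refl | refl | inj₂ refl = z≤n , <-≤-trans p≤ n₁≤s₂ , (p≤ , inj₁ z≤n)

  RArc⇒R-arc : ∀ v w → InRange v → InRange w → RArc v w → R-arc n₁ n₂ ⟦ v ⟧ ⟦ w ⟧
  RArc⇒R-arc (odd a) (odd a') _ _ (inj₁ (a<a' , a'<n)) =
    inj₁ (2 * a , 2 * a' , refl , refl , (a , a' , a<a' , a'<n , inj₁ (refl , refl)))
  RArc⇒R-arc (odd a) (odd a') ra _ (inj₂ (inj₁ (n≤a' , a'<a)))
    with ≤⇒∃+ n≤a' | ≤⇒∃+ (≤-trans n≤a' (<⇒≤ a'<a))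
  ... | i , refl | j , refl =
    inj₂ (inj₁ (2 * j , 2 * i , sym (odd+even≡odd n₁ j) , sym (odd+even≡odd n₁ i) ,
      (i , j , +-cancelˡ-< n₁ i j a'<a , +-cancelˡ-< n₁ j n₂ ra , inj₁ (refl , refl))))
  RArc⇒R-arc (odd a) (odd a') ra _ (inj₂ (inj₂ (a'<n , n≤a))) =
    inj₂ (inj₂ (inj₁ (2 * a' + 1 , suc a , <⇒odd≤even a'<n , n₁<⇒n₁+1≤ (s≤s n≤a) , ra ,
      sym (even∸1≡odd a) , refl)))
  RArc⇒R-arc (even zero) (odd a) _ _ (a<n , inj₁ _) =
    inj₂ (inj₂ (inj₂ (suc a , 0 , s≤s z≤n , a<n , inj₂ refl , refl , sym (even∸1≡odd a))))
  RArc⇒R-arc (even (suc i)) (odd a) _ _ (a<n , inj₁ i<a) =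
    inj₁ (2 * i + 1 , 2 * a , sym (odd+1≡even i) , refl ,
      (i , a , i<a , a<n , inj₂ (refl , refl)))
  RArc⇒R-arc (even m) (odd a) rm _ (a<n , inj₂ n<m) =
    inj₂ (inj₂ (inj₂ (suc a , m , s≤s z≤n , a<n , inj₁ (n₁<⇒n₁+1≤ n<m , rm) , refl ,
      sym (even∸1≡odd a))))
  RArc⇒R-arc (odd a) (even m) ra _ (n≤a , m≤a) with m ≤? n₁
  ... | yes m≤n = inj₂ (inj₂ (inj₁ (2 * m , suc a , *-monoʳ-≤ 2 m≤n ,
      n₁<⇒n₁+1≤ (s≤s n≤a) , ra , sym (even∸1≡odd a) , refl)))
  ... | no m≰n with ≰⇒> m≰n
  RArc⇒R-arc (odd a) (even (suc m)) ra _ (n≤a , m<a) | no _ | s≤s n≤m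
    with ≤⇒∃+ n≤m | ≤⇒∃+ n≤a
  ... | i , refl | j , refl =
    inj₂ (inj₁ (2 * j , 2 * i + 1 , sym (odd+even≡odd n₁ j) , sym (odd+odd≡even n₁ i) ,
      (i , j , +-cancelˡ-< n₁ i j m<a , +-cancelˡ-< n₁ j n₂ ra , inj₂ (refl , refl))))

  RArc-irrefl : ∀ v → ¬ RArc v v
  RArc-irrefl (odd a) (inj₁ (lt , _)) = <-irrefl refl lt
  RArc-irrefl (odd a) (inj₂ (inj₁ (_ , lt))) = <-irrefl refl lt
  RArc-irrefl (odd a) (inj₂ (inj₂ (lt , le))) = <⇒≱ lt le

  RArc⇒¬HEdge : ∀ v w → RArc v w → ¬ HEdge v w
  RArc⇒¬HEdge (even m) (odd a) (_ , inj₁ m≤a) (a<m , _) = <⇒≱ a<m m≤a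
  RArc⇒¬HEdge (even m) (odd a) (a<n , inj₂ n<m) (_ , imp) = <⇒≱ n<m (imp a<n)
  RArc⇒¬HEdge (odd a) (even m) (_ , m≤a) (a<m , _) = <⇒≱ a<m m≤a

  RArc-trans : ∀ u v w → RArc u v → RArc v w → RArc u w
  RArc-trans (odd a) (even m) (odd c) (n≤a , _) (c<n , _) = inj₂ (inj₂ (c<n , n≤a))
  RArc-trans (odd a) (odd b) (odd c) (inj₁ (a<b , _)) (inj₁ (b<c , c<n)) =
    inj₁ (<-trans a<b b<c , c<n)
  RArc-trans (odd a) (odd b) (odd c) (inj₁ (_ , b<n)) (inj₂ (inj₁ (n≤c , c<b))) =
    ⊥-elim (<⇒≱ b<n (≤-trans n≤c (<⇒≤ c<b)))
  RArc-trans (odd a) (odd b) (odd c) (inj₁ (_ , b<n)) (inj₂ (inj₂ (_ , n≤b))) =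
    ⊥-elim (<⇒≱ b<n n≤b)
  RArc-trans (odd a) (odd b) (odd c) (inj₂ (inj₁ (n≤b , _))) (inj₁ (b<c , c<n)) =
    ⊥-elim (<⇒≱ c<n (≤-trans n≤b (<⇒≤ b<c)))
  RArc-trans (odd a) (odd b) (odd c) (inj₂ (inj₁ (_ , b<a))) (inj₂ (inj₁ (n≤c , c<b))) =
    inj₂ (inj₁ (n≤c , <-trans c<b b<a))
  RArc-trans (odd a) (odd b) (odd c) (inj₂ (inj₁ (n≤b , b<a))) (inj₂ (inj₂ (c<n , _))) =
    inj₂ (inj₂ (c<n , ≤-trans n≤b (<⇒≤ b<a)))
  RArc-trans (odd a) (odd b) (odd c) (inj₂ (inj₂ (_ , n≤a))) (inj₁ (_ , c<n)) =
    inj₂ (inj₂ (c<n , n≤a))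
  RArc-trans (odd a) (odd b) (odd c) (inj₂ (inj₂ (b<n , _))) (inj₂ (inj₁ (n≤c , c<b))) =
    ⊥-elim (<⇒≱ b<n (≤-trans n≤c (<⇒≤ c<b)))
  RArc-trans (odd a) (odd b) (odd c) (inj₂ (inj₂ (b<n , _))) (inj₂ (inj₂ (_ , n≤b))) =
    ⊥-elim (<⇒≱ b<n n≤b)
  RArc-trans (even m) (odd b) (odd c) (_ , inj₁ m≤b) (inj₁ (b<c , c<n)) =
    c<n , inj₁ (≤-trans m≤b (<⇒≤ b<c))
  RArc-trans (even m) (odd b) (odd c) (_ , inj₂ n<m) (inj₁ (_ , c<n)) = c<n , inj₂ n<m
  RArc-trans (even m) (odd b) (odd c) (b<n , _) (inj₂ (inj₁ (n≤c , c<b))) =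
    ⊥-elim (<⇒≱ b<n (≤-trans n≤c (<⇒≤ c<b)))
  RArc-trans (even m) (odd b) (odd c) (b<n , _) (inj₂ (inj₂ (_ , n≤b))) =
    ⊥-elim (<⇒≱ b<n n≤b)
  RArc-trans (odd a) (odd b) (even m) (inj₁ (_ , b<n)) (n≤b , _) = ⊥-elim (<⇒≱ b<n n≤b)
  RArc-trans (odd a) (odd b) (even m) (inj₂ (inj₁ (_ , b<a))) (n≤b , m≤b) =
    ≤-trans n≤b (<⇒≤ b<a) , ≤-trans m≤b (<⇒≤ b<a)
  RArc-trans (odd a) (odd b) (even m) (inj₂ (inj₂ (b<n , _))) (n≤b , _) =
    ⊥-elim (<⇒≱ b<n n≤b)
  RArc-trans (even m) (odd b) (even m') (b<n , _) (n≤b , _) = ⊥-elim (<⇒≱ b<n n≤b)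

  RArc-asym : ∀ v w → RArc v w → ¬ RArc w v
  RArc-asym v w r r' = RArc-irrefl v (RArc-trans v w v r r')

  ¬HEdge⇒RArc-odd-even : ∀ a m → ¬ HEdge (odd a) (even m) →
                         RArc (odd a) (even m) ⊎ RArc (even m) (odd a)
  ¬HEdge⇒RArc-odd-even a m ¬h with a <? n₁ | m ≤? a
  ... | no a≮n | yes m≤a = inj₁ (≮⇒≥ a≮n , m≤a)
  ... | no a≮n | no m≰a = ⊥-elim (¬h (≰⇒> m≰a , λ a<n → ⊥-elim (a≮n a<n)))
  ... | yes a<n | yes m≤a = inj₂ (a<n , inj₁ m≤a)
  ... | yes a<n | no m≰a with m ≤? n₁
  ...   | yes m≤n = ⊥-elim (¬h (≰⇒> m≰a , λ _ → m≤n))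
  ...   | no m≰n = inj₂ (a<n , inj₂ (≰⇒> m≰n))

  RArc-odd-total : ∀ a a' → a ≢ a' → RArc (odd a) (odd a') ⊎ RArc (odd a') (odd a)
  RArc-odd-total a a' a≢a' with <-cmp a a' | a <? n₁ | a' <? n₁
  ... | tri≈ _ a≡a' _ | _ | _ = ⊥-elim (a≢a' a≡a')
  ... | tri< lt _ _ | _ | yes a'<n = inj₁ (inj₁ (lt , a'<n))
  ... | tri< lt _ _ | yes a<n | no a'≮n = inj₂ (inj₂ (inj₂ (a<n , ≮⇒≥ a'≮n)))
  ... | tri< lt _ _ | no a≮n | no a'≮n = inj₂ (inj₂ (inj₁ (≮⇒≥ a≮n , lt)))
  ... | tri> _ _ gt | yes a<n | _ = inj₂ (inj₁ (gt , a<n))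
  ... | tri> _ _ gt | no a≮n | yes a'<n = inj₁ (inj₂ (inj₂ (a'<n , ≮⇒≥ a≮n)))
  ... | tri> _ _ gt | no a≮n | no a'≮n = inj₁ (inj₂ (inj₁ (≮⇒≥ a'≮n , gt)))

  ¬HEdge⇒RArc : ∀ v w → v ≢ w → ¬ HEdge v w → RArc v w ⊎ RArc w v
  ¬HEdge⇒RArc (even m) (even m') v≢w ¬h = ⊥-elim (¬h (λ m≡m' → v≢w (cong even m≡m')))
  ¬HEdge⇒RArc (odd a) (even m) _ ¬h = ¬HEdge⇒RArc-odd-even a m ¬h
  ¬HEdge⇒RArc (even m) (odd a) _ ¬h = swap (¬HEdge⇒RArc-odd-even a m ¬h)
  ¬HEdge⇒RArc (odd a) (odd a') v≢w _ = RArc-odd-total a a' (λ a≡a' → v≢w (cong odd a≡a'))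

R-isTransitiveOrientation : ∀ n₁ n₂ → IsTransitiveOrientation (R n₁ n₂) (complement (H n₁ n₂))
R-isTransitiveOrientation n₁ n₂ = record
  { sameVertices = refl
  ; arcIsEdge = arcIsEdge
  ; edgeHasArc = edgeHasArc
  ; notBoth = notBoth
  ; transitive = transitive
  }
  where
  open Coordinates n₁ n₂

  arcIsEdge : ∀ x y → R-arc n₁ n₂ x y → Adj (complement (H n₁ n₂)) x y
  arcIsEdge x y arc with ⟦⟧-surjective x | ⟦⟧-surjective y
  ... | v , refl | w , refl with R-arc⇒RArc v w arc
  ... | rv , rw , r =
    InRange⇒< v rv , InRange⇒< w rw ,
    (λ e → RArc-irrefl v (subst (RArc v) (sym (⟦⟧-injective v w e)) r)) ,
    (λ h → RArc⇒¬HEdge v w r (H-adj⇒HEdge v w h))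

  edgeHasArc : ∀ x y → Adj (complement (H n₁ n₂)) x y → R-arc n₁ n₂ x y ⊎ R-arc n₁ n₂ y x
  edgeHasArc x y (x< , y< , x≢y , ¬adj) with ⟦⟧-surjective x | ⟦⟧-surjective y
  ... | v , refl | w , refl =
    Sum.map (RArc⇒R-arc v w rv rw) (RArc⇒R-arc w v rw rv)
      (¬HEdge⇒RArc v w (x≢y ∘ cong ⟦_⟧) (¬adj ∘ HEdge⇒H-adj v w rv rw))
    where
    rv : InRange v
    rv = <⇒InRange v x<
    rw : InRange w
    rw = <⇒InRange w y<

  notBoth : ∀ x y → Adj (complement (H n₁ n₂)) x y → ¬ (R-arc n₁ n₂ x y × R-arc n₁ n₂ y x)
  notBoth x y _ (a₁ , a₂) with ⟦⟧-surjective x | ⟦⟧-surjective y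
  ... | v , refl | w , refl =
    RArc-asym v w (proj₂ (proj₂ (R-arc⇒RArc v w a₁))) (proj₂ (proj₂ (R-arc⇒RArc w v a₂)))

  transitive : ∀ x y z → R-arc n₁ n₂ x y → R-arc n₁ n₂ y z → R-arc n₁ n₂ x z
  transitive x y z a₁ a₂ with ⟦⟧-surjective x | ⟦⟧-surjective y | ⟦⟧-surjective z
  ... | u , refl | v , refl | w , refl with R-arc⇒RArc u v a₁ | R-arc⇒RArc v w a₂
  ... | ru , _ , r₁ | _ , rw , r₂ = RArc⇒R-arc u w ru rw (RArc-trans u v w r₁ r₂)

-- The construction also works when n₁ or n₂ is 0.
mainTheorem8 : (n₁ n₂ : ℕ) → 1 ≤ n₁ → 1 ≤ n₂ →
    IsTransitiveOrientation (R n₁ n₂) (complement (H n₁ n₂)) ×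
    IsComparabilityGraph (complement (H n₁ n₂))
mainTheorem8 n₁ n₂ _ _ = orientation , (R n₁ n₂ , orientation)
  where
  orientation : IsTransitiveOrientation (R n₁ n₂) (complement (H n₁ n₂))
  orientation = R-isTransitiveOrientation n₁ n₂
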